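{- If a cubic graph $G$ admits a $\{K_{1,3},K_3\}$-decomposition $D$, then every isolated triangle of $G$ is a part of $D$.
   Context: All graphs are finite, simple, connected and nontrivial. A graph is cubic if every vertex has degree $3$. $K_{1,3}$ is the star with three edges and $K_3$ the triangle. A $\{K_{1,3},K_3\}$-decomposition of $G$ is a partition of $E(G)$ into subgraphs (parts) each isomorphic to $K_{1,3}$ or $K_3$. A triangle of $G$ on vertices $\{u,v,w\}$ is isolated if there is no vertex $x$ of $G$ such that $\{u,v,x\}$, $\{u,x,w\}$ or $\{x,v,w\}$ induces a triangle. -}

module Defs where

open import Data.Nat using (ℕ; _≤_)
open import Data.Fin using (Fin)
open import Data.Bool using (Bool; true; false; T)
open import Data.List using (List; length; filterᵇ; lookup)
open import Data.List.Base using ()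
open import Data.Fin.Base using ()
open import Data.List using (allFin)
open import Data.Product using (Σ; ∃; _×_; _,_)
open import Data.Sum using (_⊎_)
open import Relation.Binary.PropositionalEquality using (_≡_; _≢_)
open import Relation.Nullary using (¬_)
open import Data.Empty using (⊥)

record Graph : Set where
  field
    n      : ℕ
    adj    : Fin n → Fin n → Bool
    symm   : ∀ u v → adj u v ≡ adj v u
    irrefl : ∀ u → adj u u ≡ false

open Graph public

Adj : (G : Graph) → Fin (n G) → Fin (n G) → Set
Adj G u v = T (adj G u v)

data Reach (G : Graph) : Fin (n G) → Fin (n G) → Set where
  here : ∀ {u} → Reach G u u
  step : ∀ {u v w} → Adj G u v → Reach G v w → Reach G u w

Connected : Graph → Set
Connected G = ∀ u v → Reach G u v

Nontrivial : Graph → Set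
Nontrivial G = 2 ≤ n G

degree : (G : Graph) → Fin (n G) → ℕ
degree G u = length (filterᵇ (adj G u) (allFin (n G)))

Cubic : Graph → Set
Cubic G = ∀ u → degree G u ≡ 3

data Part (m : ℕ) : Set where
  star : (c a b d : Fin m) → Part m     -- K_{1,3}: centre c, leaves a b d
  tri  : (x y z : Fin m) → Part m

SameEdge : ∀ {m} → Fin m → Fin m → Fin m → Fin m → Set
SameEdge u v a b = (u ≡ a × v ≡ b) ⊎ (u ≡ b × v ≡ a)

EdgeOf : ∀ {m} → Part m → Fin m → Fin m → Set
EdgeOf (star c a b d) u v = SameEdge u v c a ⊎ SameEdge u v c b ⊎ SameEdge u v c d
EdgeOf (tri x y z)    u v = SameEdge u v x y ⊎ SameEdge u v y z ⊎ SameEdge u v x z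

Distinct3 : ∀ {m} → Fin m → Fin m → Fin m → Set
Distinct3 a b c = a ≢ b × b ≢ c × a ≢ c

ValidPart : (G : Graph) → Part (n G) → Set
ValidPart G (star c a b d) =
  Distinct3 a b d × Adj G c a × Adj G c b × Adj G c d
ValidPart G (tri x y z) = Adj G x y × Adj G y z × Adj G x z

-- Since parts are subgraphs of G, they partition E(G).
Decomposition : (G : Graph) → List (Part (n G)) → Set
Decomposition G D =
  (∀ i → ValidPart G (lookup D i)) ×
  (∀ u v → Adj G u v →
     Σ (Fin (length D)) λ i → EdgeOf (lookup D i) u v ×
       (∀ j → EdgeOf (lookup D j) u v → j ≡ i))

IsTriangle : (G : Graph) → Fin (n G) → Fin (n G) → Fin (n G) → Set
IsTriangle G u v w = Adj G u v × Adj G v w × Adj G u w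

IsolatedTriangle : (G : Graph) → Fin (n G) → Fin (n G) → Fin (n G) → Set
IsolatedTriangle G u v w =
  IsTriangle G u v w ×
  (∀ x → x ≢ w → ¬ IsTriangle G u v x) ×
  (∀ x → x ≢ v → ¬ IsTriangle G u x w) ×
  (∀ x → x ≢ u → ¬ IsTriangle G x v w)

In3 : ∀ {m} → Fin m → Fin m → Fin m → Fin m → Set
In3 t a b c = t ≡ a ⊎ t ≡ b ⊎ t ≡ c

IsTrianglePart : ∀ {m} → Part m → Fin m → Fin m → Fin m → Set
IsTrianglePart (star _ _ _ _) u v w = ⊥
IsTrianglePart (tri x y z) u v w =
  ∀ t → (In3 t x y z → In3 t u v w) × (In3 t u v w → In3 t x y z)

module Submission where

-- Let uvw be an isolated triangle of the cubic graph G, so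
-- that any two of u, v, w have the third as their only common neighbour,
-- and let P be the part of the decomposition D containing the edge uv.
--   * If P is a triangle, its third vertex is a common neighbour of u and
--     v, hence equals w, and P is the triangle uvw.
--   * If P is a star, its centre is u or v, say u.  As u has degree 3, the
--     three leaves of P are all the neighbours of u, so P also contains uw.
--     The part Q containing vw contains uv or uw (a star centred at v or w
--     absorbs all edges at its centre; a triangle through vw has apex u),
--     so Q = P by uniqueness of the covering part.  But a star centred at u
--     cannot contain vw: contradiction.

open import Defs
open import Data.Nat using (suc; _≤_; z≤n; s≤s)
open import Data.List using (List; []; _∷_; length; lookup; filterᵇ; allFin)
open import Data.List.Membership.Propositional using (_∈_)
open import Data.List.Membership.Propositional.Properties using (∈-allFin; ∈-filter⁺)
open import Data.List.Relation.Unary.Any using (here; there)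
open import Data.List.Relation.Unary.All as All using ([]; _∷_)
open import Data.List.Relation.Unary.AllPairs using ([]; _∷_)
open import Data.List.Relation.Unary.Unique.Propositional using (Unique)
open import Data.List.Relation.Binary.Subset.Propositional using (_⊆_)
open import Data.Fin using (Fin; _≟_)
open import Data.Bool using (T; T?)
open import Data.Product using (Σ; _×_; _,_; proj₁; proj₂)
open import Data.Sum using (_⊎_; inj₁; inj₂)
open import Data.Empty using (⊥; ⊥-elim)
open import Relation.Nullary using (¬_; yes; no)
open import Relation.Binary.PropositionalEquality using (_≡_; _≢_; refl; sym; trans; cong; subst)
open import Function using (_∘_; id)

removeMember : ∀ {A : Set} {x : A} {ys : List A} → x ∈ ys →
               Σ (List A) λ zs → (length ys ≡ suc (length zs)) ×
                                 (∀ {y} → y ≢ x → y ∈ ys → y ∈ zs)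
removeMember {ys = _ ∷ ys} (here refl) = ys , refl , keep
  where
  keep : ∀ {y} → y ≢ _ → y ∈ _ → y ∈ ys
  keep y≢x (here y≡x) = ⊥-elim (y≢x y≡x)
  keep y≢x (there y∈ys) = y∈ys
removeMember {ys = z ∷ ys} (there x∈ys) with removeMember x∈ys
... | zs , len , keep = z ∷ zs , cong suc len , keep′
  where
  keep′ : ∀ {y} → y ≢ _ → y ∈ z ∷ ys → y ∈ z ∷ zs
  keep′ y≢x (here y≡z) = here y≡z
  keep′ y≢x (there y∈ys) = there (keep y≢x y∈ys)

unique⊆⇒length≤ : ∀ {A : Set} {xs ys : List A} → Unique xs → xs ⊆ ys →
                  length xs ≤ length ys
unique⊆⇒length≤ [] _ = z≤n
unique⊆⇒length≤ {xs = x ∷ xs} (x∉xs ∷ uniq) xs⊆ys with removeMember (xs⊆ys (here refl))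
... | zs , len , keep =
  subst (suc (length xs) ≤_) (sym len)
        (s≤s (unique⊆⇒length≤ uniq λ y∈xs →
                keep (λ y≡x → All.lookup x∉xs y∈xs (sym y≡x)) (xs⊆ys (there y∈xs))))

in3-swap₁₂ : ∀ {m} {s a b c : Fin m} → In3 s a b c → In3 s b a c
in3-swap₁₂ (inj₁ e) = inj₂ (inj₁ e)
in3-swap₁₂ (inj₂ (inj₁ e)) = inj₁ e
in3-swap₁₂ (inj₂ (inj₂ e)) = inj₂ (inj₂ e)

in3-swap₂₃ : ∀ {m} {s a b c : Fin m} → In3 s a b c → In3 s a c b
in3-swap₂₃ (inj₁ e) = inj₁ e
in3-swap₂₃ (inj₂ (inj₁ e)) = inj₂ (inj₂ e)
in3-swap₂₃ (inj₂ (inj₂ e)) = inj₂ (inj₁ e)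

in3-swap₁₃ : ∀ {m} {s a b c : Fin m} → In3 s a b c → In3 s c b a
in3-swap₁₃ (inj₁ e) = inj₂ (inj₂ e)
in3-swap₁₃ (inj₂ (inj₁ e)) = inj₂ (inj₁ e)
in3-swap₁₃ (inj₂ (inj₂ e)) = inj₁ e

sameEdge-sym : ∀ {m} {u v a b : Fin m} → SameEdge u v a b → SameEdge v u a b
sameEdge-sym (inj₁ (u≡a , v≡b)) = inj₂ (v≡b , u≡a)
sameEdge-sym (inj₂ (u≡b , v≡a)) = inj₁ (v≡a , u≡b)

edgeOf-sym : ∀ {m} (P : Part m) {u v} → EdgeOf P u v → EdgeOf P v u
edgeOf-sym (star _ _ _ _) (inj₁ e) = inj₁ (sameEdge-sym e)
edgeOf-sym (star _ _ _ _) (inj₂ (inj₁ e)) = inj₂ (inj₁ (sameEdge-sym e))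
edgeOf-sym (star _ _ _ _) (inj₂ (inj₂ e)) = inj₂ (inj₂ (sameEdge-sym e))
edgeOf-sym (tri _ _ _) (inj₁ e) = inj₁ (sameEdge-sym e)
edgeOf-sym (tri _ _ _) (inj₂ (inj₁ e)) = inj₂ (inj₁ (sameEdge-sym e))
edgeOf-sym (tri _ _ _) (inj₂ (inj₂ e)) = inj₂ (inj₂ (sameEdge-sym e))

CentredAt : ∀ {m} → Part m → Fin m → Set
CentredAt (star c _ _ _) x = x ≡ c
CentredAt (tri _ _ _) _ = ⊥

centreOnEdge : ∀ {m} {P : Part m} {c x y : Fin m} → CentredAt P c → EdgeOf P x y →
               x ≡ c ⊎ y ≡ c
centreOnEdge {P = star _ _ _ _} refl = atCentre
  where
  atCentre : ∀ {c a b d x y} → EdgeOf (star c a b d) x y → x ≡ c ⊎ y ≡ c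
  atCentre (inj₁ (inj₁ (x≡c , _))) = inj₁ x≡c
  atCentre (inj₁ (inj₂ (_ , y≡c))) = inj₂ y≡c
  atCentre (inj₂ (inj₁ (inj₁ (x≡c , _)))) = inj₁ x≡c
  atCentre (inj₂ (inj₁ (inj₂ (_ , y≡c)))) = inj₂ y≡c
  atCentre (inj₂ (inj₂ (inj₁ (x≡c , _)))) = inj₁ x≡c
  atCentre (inj₂ (inj₂ (inj₂ (_ , y≡c)))) = inj₂ y≡c

ApexOf : ∀ {m} → Part m → Fin m → Fin m → Fin m → Set
ApexOf P x y t = EdgeOf P x t × EdgeOf P y t × IsTrianglePart P x y t

triangleApex : ∀ {m} {a b c x y : Fin m} → EdgeOf (tri a b c) x y →
               Σ (Fin m) (ApexOf (tri a b c) x y)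
triangleApex {c = c} (inj₁ (inj₁ (refl , refl))) =
  c , inj₂ (inj₂ (inj₁ (refl , refl))) , inj₂ (inj₁ (inj₁ (refl , refl))) , λ _ → id , id
triangleApex {c = c} (inj₁ (inj₂ (refl , refl))) =
  c , inj₂ (inj₁ (inj₁ (refl , refl))) , inj₂ (inj₂ (inj₁ (refl , refl))) , λ _ → in3-swap₁₂ , in3-swap₁₂
triangleApex {a = a} (inj₂ (inj₁ (inj₁ (refl , refl)))) =
  a , inj₁ (inj₂ (refl , refl)) , inj₂ (inj₂ (inj₂ (refl , refl))) ,
  λ _ → in3-swap₂₃ ∘ in3-swap₁₂ , in3-swap₁₂ ∘ in3-swap₂₃
triangleApex {a = a} (inj₂ (inj₁ (inj₂ (refl , refl)))) =
  a , inj₂ (inj₂ (inj₂ (refl , refl))) , inj₁ (inj₂ (refl , refl)) , λ _ → in3-swap₁₃ , in3-swap₁₃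
triangleApex {b = b} (inj₂ (inj₂ (inj₁ (refl , refl)))) =
  b , inj₁ (inj₁ (refl , refl)) , inj₂ (inj₁ (inj₂ (refl , refl))) , λ _ → in3-swap₂₃ , in3-swap₂₃
triangleApex {b = b} (inj₂ (inj₂ (inj₂ (refl , refl)))) =
  b , inj₂ (inj₁ (inj₂ (refl , refl))) , inj₁ (inj₁ (refl , refl)) ,
  λ _ → in3-swap₁₂ ∘ in3-swap₂₃ , in3-swap₂₃ ∘ in3-swap₁₂

partThroughEdge : ∀ {m} {P : Part m} {x y : Fin m} → EdgeOf P x y →
                  CentredAt P x ⊎ CentredAt P y ⊎ Σ (Fin m) (ApexOf P x y)
partThroughEdge {P = star _ _ _ _} e with centreOnEdge {P = star _ _ _ _} refl e
... | inj₁ x≡c = inj₁ x≡c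
... | inj₂ y≡c = inj₂ (inj₁ y≡c)
partThroughEdge {P = tri _ _ _} e = inj₂ (inj₂ (triangleApex e))

module GraphFacts (G : Graph) where

  V : Set
  V = Fin (n G)

  adjSym : ∀ {u v : V} → Adj G u v → Adj G v u
  adjSym {u} {v} = subst T (symm G u v)

  adj⇒≢ : ∀ {u v : V} → Adj G u v → u ≢ v
  adj⇒≢ {u} uu refl = subst T (irrefl G u) uu

  sameEdgeAdj : ∀ {a b x y : V} → Adj G a b → SameEdge x y a b → Adj G x y
  sameEdgeAdj ab (inj₁ (refl , refl)) = ab
  sameEdgeAdj ab (inj₂ (refl , refl)) = adjSym ab

  partEdgeAdj : ∀ {P : Part (n G)} {x y} → ValidPart G P → EdgeOf P x y → Adj G x y
  partEdgeAdj {star _ _ _ _} (_ , ca , _ , _) (inj₁ e) = sameEdgeAdj ca e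
  partEdgeAdj {star _ _ _ _} (_ , _ , cb , _) (inj₂ (inj₁ e)) = sameEdgeAdj cb e
  partEdgeAdj {star _ _ _ _} (_ , _ , _ , cd) (inj₂ (inj₂ e)) = sameEdgeAdj cd e
  partEdgeAdj {tri _ _ _} (xy , _ , _) (inj₁ e) = sameEdgeAdj xy e
  partEdgeAdj {tri _ _ _} (_ , yz , _) (inj₂ (inj₁ e)) = sameEdgeAdj yz e
  partEdgeAdj {tri _ _ _} (_ , _ , xz) (inj₂ (inj₂ e)) = sameEdgeAdj xz e

  neighbours : V → List V
  neighbours c = filterᵇ (adj G c) (allFin (n G))

  ∈-neighbours : ∀ {c e : V} → Adj G c e → e ∈ neighbours c
  ∈-neighbours {c} {e} = ∈-filter⁺ (T? ∘ adj G c) (∈-allFin e)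

  -- In a cubic graph the three leaves of a star are all the neighbours of
  -- its centre: a fourth neighbour would give degree at least 4.
  neighbourIsLeaf : Cubic G → ∀ {c a b d e : V} → ValidPart G (star c a b d) →
                    Adj G c e → In3 e a b d
  neighbourIsLeaf cubic {c} {a} {b} {d} {e} ((a≢b , b≢d , a≢d) , ca , cb , cd) ce
    with e ≟ a | e ≟ b | e ≟ d
  ... | yes e≡a | _ | _ = inj₁ e≡a
  ... | no _ | yes e≡b | _ = inj₂ (inj₁ e≡b)
  ... | no _ | no _ | yes e≡d = inj₂ (inj₂ e≡d)
  ... | no e≢a | no e≢b | no e≢d = ⊥-elim (fourNotBelowThree (subst (4 ≤_) (cubic c)
          (unique⊆⇒length≤ distinct fourNeighbours)))
    where
    distinct : Unique (a ∷ b ∷ d ∷ e ∷ [])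
    distinct = (a≢b ∷ a≢d ∷ (e≢a ∘ sym) ∷ [])
             ∷ (b≢d ∷ (e≢b ∘ sym) ∷ [])
             ∷ ((e≢d ∘ sym) ∷ [])
             ∷ [] ∷ []
    fourNeighbours : (a ∷ b ∷ d ∷ e ∷ []) ⊆ neighbours c
    fourNeighbours (here refl) = ∈-neighbours ca
    fourNeighbours (there (here refl)) = ∈-neighbours cb
    fourNeighbours (there (there (here refl))) = ∈-neighbours cd
    fourNeighbours (there (there (there (here refl)))) = ∈-neighbours ce
    fourNotBelowThree : ¬ (4 ≤ 3)
    fourNotBelowThree (s≤s (s≤s (s≤s ())))

  starAbsorbs : Cubic G → ∀ {P : Part (n G)} {c e} → ValidPart G P → CentredAt P c →
                Adj G c e → EdgeOf P c e
  starAbsorbs cubic {star _ _ _ _} valid refl ce with neighbourIsLeaf cubic valid ce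
  ... | inj₁ e≡a = inj₁ (inj₁ (refl , e≡a))
  ... | inj₂ (inj₁ e≡b) = inj₂ (inj₁ (inj₁ (refl , e≡b)))
  ... | inj₂ (inj₂ e≡d) = inj₂ (inj₂ (inj₁ (refl , e≡d)))

  UniqueApex : V → V → V → Set
  UniqueApex x y z = ∀ t → Adj G x t → Adj G y t → t ≡ z

  Isolated : V → V → V → Set
  Isolated u v w = Adj G u v × Adj G v w × Adj G u w ×
                   UniqueApex u v w × UniqueApex v w u × UniqueApex u w v

  isolated-swap : ∀ {u v w} → Isolated u v w → Isolated v u w
  isolated-swap (uv , vw , uw , uvApex , vwApex , uwApex) =
    adjSym uv , uw , vw , (λ t vt ut → uvApex t ut vt) , uwApex , vwApex

  fromIsolatedTriangle : ∀ {u v w} → IsolatedTriangle G u v w → Isolated u v w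
  fromIsolatedTriangle {u} {v} {w} ((uv , vw , uw) , noApexUV , noApexUW , noApexVW) =
    uv , vw , uw , uvApex , vwApex , uwApex
    where
    uvApex : UniqueApex u v w
    uvApex t ut vt with t ≟ w
    ... | yes t≡w = t≡w
    ... | no t≢w = ⊥-elim (noApexUV t t≢w (uv , vt , ut))
    vwApex : UniqueApex v w u
    vwApex t vt wt with t ≟ u
    ... | yes t≡u = t≡u
    ... | no t≢u = ⊥-elim (noApexVW t t≢u (adjSym vt , vw , adjSym wt))
    uwApex : UniqueApex u w v
    uwApex t ut wt with t ≟ v
    ... | yes t≡v = t≡v
    ... | no t≢v = ⊥-elim (noApexUW t t≢v (ut , adjSym wt , uw))

  partThroughOppositeEdge : Cubic G → ∀ {u v w} {P : Part (n G)} → Isolated u v w →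
                            ValidPart G P → EdgeOf P v w → EdgeOf P u v ⊎ EdgeOf P u w
  partThroughOppositeEdge cubic {P = P} (uv , vw , uw , _ , vwApex , _) valid e
    with partThroughEdge {P = P} e
  ... | inj₁ centredV = inj₁ (edgeOf-sym P (starAbsorbs cubic valid centredV (adjSym uv)))
  ... | inj₂ (inj₁ centredW) = inj₂ (edgeOf-sym P (starAbsorbs cubic valid centredW (adjSym uw)))
  ... | inj₂ (inj₂ (t , vt , wt , _))
    with vwApex t (partEdgeAdj valid vt) (partEdgeAdj valid wt)
  ...   | refl = inj₁ (edgeOf-sym P vt)

  module Decomposed (D : List (Part (n G))) (dec : Decomposition G D) where

    valid : ∀ i → ValidPart G (lookup D i)
    valid = proj₁ dec

    partOf : ∀ {x y} → Adj G x y → Fin (length D)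
    partOf {x} {y} xy = proj₁ (proj₂ dec x y xy)

    partOf-covers : ∀ {x y} (xy : Adj G x y) → EdgeOf (lookup D (partOf xy)) x y
    partOf-covers {x} {y} xy = proj₁ (proj₂ (proj₂ dec x y xy))

    coveringUnique : ∀ {x y} {i j} → Adj G x y → EdgeOf (lookup D i) x y →
                     EdgeOf (lookup D j) x y → i ≡ j
    coveringUnique {x} {y} {i} {j} xy xyInI xyInJ =
      trans (onlyPart i xyInI) (sym (onlyPart j xyInJ))
      where
      onlyPart : ∀ k → EdgeOf (lookup D k) x y → k ≡ partOf xy
      onlyPart = proj₂ (proj₂ (proj₂ dec x y xy))

    -- No part is a star centred at a corner u of an isolated triangle uvw:
    -- such a star contains uv and uw, hence is also the part covering vw,
    -- yet vw does not pass through its centre.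
    noStarAtCorner : Cubic G → ∀ {u v w i} → Isolated u v w → ¬ CentredAt (lookup D i) u
    noStarAtCorner cubic {u} {v} {w} {i} iso@(uv , vw , uw , _) centredU =
      vwMissesCentre (centreOnEdge {P = lookup D i} centredU vwInI)
      where
      uvInI : EdgeOf (lookup D i) u v
      uvInI = starAbsorbs cubic (valid i) centredU uv
      uwInI : EdgeOf (lookup D i) u w
      uwInI = starAbsorbs cubic (valid i) centredU uw
      vwPart≡i : partOf vw ≡ i
      vwPart≡i with partThroughOppositeEdge cubic iso (valid (partOf vw)) (partOf-covers vw)
      ... | inj₁ uvInVwPart = coveringUnique uv uvInVwPart uvInI
      ... | inj₂ uwInVwPart = coveringUnique uw uwInVwPart uwInI
      vwInI : EdgeOf (lookup D i) v w
      vwInI = subst (λ k → EdgeOf (lookup D k) v w) vwPart≡i (partOf-covers vw)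
      vwMissesCentre : ¬ (v ≡ u ⊎ w ≡ u)
      vwMissesCentre (inj₁ v≡u) = adj⇒≢ uv (sym v≡u)
      vwMissesCentre (inj₂ w≡u) = adj⇒≢ uw (sym w≡u)

    -- The part covering uv is therefore a triangle, whose third vertex is a
    -- common neighbour of u and v, that is, w.
    isolatedTriangleIsPart : Cubic G → ∀ {u v w} → Isolated u v w →
                             Σ (Fin (length D)) λ i → IsTrianglePart (lookup D i) u v w
    isolatedTriangleIsPart cubic iso@(uv , _ , _ , uvApex , _)
      with partThroughEdge {P = lookup D (partOf uv)} (partOf-covers uv)
    ... | inj₁ centredU = ⊥-elim (noStarAtCorner cubic iso centredU)
    ... | inj₂ (inj₁ centredV) = ⊥-elim (noStarAtCorner cubic (isolated-swap iso) centredV)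
    ... | inj₂ (inj₂ (t , ut , vt , triangle))
      with uvApex t (partEdgeAdj (valid (partOf uv)) ut) (partEdgeAdj (valid (partOf uv)) vt)
    ...   | refl = partOf uv , triangle

lemma1 : (G : Graph) → Connected G → Nontrivial G → Cubic G →
         (D : List (Part (n G))) → Decomposition G D →
         ∀ u v w → IsolatedTriangle G u v w →
         Σ (Fin (length D)) λ i → IsTrianglePart (lookup D i) u v w
lemma1 G _ _ cubic D dec u v w isolated =
  isolatedTriangleIsPart cubic (fromIsolatedTriangle isolated)
  where
  open GraphFacts G
  open Decomposed D dec
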